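{- Let $\kappa$ be an infinite cardinal and $R \subseteq \kappa \times \kappa$ a rigid symmetric relation. Let $\Phi$ be the family of all relations $S \subseteq \kappa \times \kappa$ such that (1) $R \subseteq S$; (2) for all $\alpha,\beta \in \kappa$ with $\alpha \neq \beta$, $\alpha S \beta$ or $\beta S \alpha$; (3) for all $\alpha,\beta \in \kappa$, if $\alpha S \beta$ and $\beta S \alpha$ then $\alpha R \beta$ and $\beta R \alpha$. If $S_1, S_2 \in \Phi$ and $f : \kappa \to \kappa$ is a homomorphism $\langle \kappa, S_1\rangle \to \langle \kappa, S_2\rangle$, then $f$ is a homomorphism $\langle \kappa, R\rangle \to \langle \kappa, R\rangle$.
   Context: A map $f : X \to Y$ is a homomorphism $\langle X, P\rangle \to \langle Y, Q\rangle$ (where $P \subseteq X\times X$, $Q \subseteq Y \times Y$) if $(u,v) \in P$ implies $(f(u),f(v)) \in Q$. A relation $R \subseteq \kappa\times\kappa$ is rigid if the identity is the only homomorphism $\langle \kappa, R\rangle \to \langle \kappa, R\rangle$. -}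

module Defs where

open import Data.Nat using (ℕ)
open import Data.Product using (_×_; Σ)
open import Data.Sum using (_⊎_)
open import Relation.Binary.PropositionalEquality using (_≡_; _≢_)
open import Function.Definitions using (Injective)

Rel₂ : Set → Set₁
Rel₂ X = X → X → Set

-- X is infinite: ℕ injects into X (Dedekind-style; stands for "κ infinite").
Infinite : Set → Set
Infinite X = Σ (ℕ → X) (λ g → Injective _≡_ _≡_ g)

IsHom : {X : Set} → Rel₂ X → Rel₂ X → (X → X) → Set
IsHom P Q f = ∀ u v → P u v → Q (f u) (f v)

Rigid : {X : Set} → Rel₂ X → Set
Rigid {X} R = (g : X → X) → IsHom R R g → ∀ x → g x ≡ x

Symmetric : {X : Set} → Rel₂ X → Set
Symmetric R = ∀ a b → R a b → R b a

InΦ : {X : Set} → Rel₂ X → Rel₂ X → Set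
InΦ R S =
  (∀ a b → R a b → S a b) ×
  (∀ a b → a ≢ b → S a b ⊎ S b a) ×
  (∀ a b → S a b → S b a → R a b × R b a)

module Submission where

open import Defs
open import Data.Product using (_×_; _,_; proj₁; uncurry)
open import Function using (_∘_)

-- Condition (1) and the symmetry of R put each R-edge into S₁ in both directions;
-- f carries it to an edge of S₂ in both directions, which condition (3) puts back
-- into R.

SymmetricPart : {X : Set} → Rel₂ X → Rel₂ X
SymmetricPart S a b = S a b × S b a

IsHom-SymmetricPart : {X : Set} {S₁ S₂ : Rel₂ X} (f : X → X) →
  IsHom S₁ S₂ f → IsHom (SymmetricPart S₁) (SymmetricPart S₂) f
IsHom-SymmetricPart f hom u v (s₁uv , s₁vu) = hom u v s₁uv , hom v u s₁vu

Symmetric⇒⊆SymmetricPart : {X : Set} {R S : Rel₂ X} → Symmetric R →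
  (∀ a b → R a b → S a b) → ∀ a b → R a b → SymmetricPart S a b
Symmetric⇒⊆SymmetricPart sym R⊆S a b rab = R⊆S a b rab , R⊆S b a (sym a b rab)

InΦ⇒SymmetricPart⊆ : {X : Set} {R S : Rel₂ X} → InΦ R S →
  ∀ a b → SymmetricPart S a b → R a b
InΦ⇒SymmetricPart⊆ (_ , _ , antisym) a b = proj₁ ∘ uncurry (antisym a b)

lemma1 : (X : Set) → Infinite X → (R : Rel₂ X) → Rigid R → Symmetric R →
    (S₁ S₂ : Rel₂ X) → InΦ R S₁ → InΦ R S₂ →
    (f : X → X) → IsHom S₁ S₂ f → IsHom R R f
lemma1 X _ R _ sym S₁ S₂ (R⊆S₁ , _) S₂∈Φ f hom u v ruv =
  InΦ⇒SymmetricPart⊆ S₂∈Φ (f u) (f v)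
    (IsHom-SymmetricPart {S₂ = S₂} f hom u v (Symmetric⇒⊆SymmetricPart sym R⊆S₁ u v ruv))
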